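{- Let $d\in\mathbb{N}$ with $d\ge2$ and let $G\in\mathcal{C}_d$ with $n=|V(G)|$. For all $0\le\epsilon<1/(2d)$ there is a number $\lambda=\lambda(\epsilon,d)\in(0,1)$ such that if there are $\lambda n$ subsets of $V(G)$ whose closed neighbourhoods are pairwise disjoint and each of which witnesses non-Hamiltonicity, then $G$ is $\epsilon$-far from being Hamiltonian.
   Context: $\mathcal{C}_d$ is the class of simple graphs of maximum degree at most $d$. For $S\subseteq V(G)$, $N_G(S)=S\cup\{v: v\text{ adjacent to some }w\in S\}$ is the closed neighbourhood; $G[X]$ is the induced subgraph on $X$. A set $S\subseteq V(G)$ witnesses non-Hamiltonicity (of $G\in\mathcal{C}_d$) if for every Hamiltonian graph $H\in\mathcal{C}_d$ with $|V(H)|=|V(G)|$ and every $T\subseteq V(H)$ there is no isomorphism from $G[N_G(S)]$ to $H[N_H(T)]$ mapping $S$ onto $T$. $G\in\mathcal{C}_d$ is $\epsilon$-far from being Hamiltonian if for every set $E$ of 2-element subsets of $V(G)$ with $|E|\le\epsilon d|V(G)|$ the graph $(V(G),E(G)\triangle E)$ is not Hamiltonian.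
   Formalization: The parameter ε ranges over the rationals, and the number λ is taken in the rationals. -}

module Defs where

open import Data.Nat using (ℕ; zero; suc; _+_; _*_; _∸_; _≤_; _<ᵇ_)
open import Data.Fin using (Fin; toℕ)
open import Data.Bool using (Bool; true; false; _∧_; _∨_; _xor_)
open import Data.List using (List; allFin; map)
open import Data.Nat.ListAction using (sum)
open import Data.Bool.ListAction using (any)
open import Data.Vec using (tabulate; lookup)
open import Data.Fin.Subset using (Subset; ∣_∣)
open import Data.Integer using (+_)
open import Data.Rational using (ℚ; _/_)
import Data.Rational as ℚ
open import Data.Product using (Σ; ∃; _×_)
open import Relation.Binary.PropositionalEquality using (_≡_; _≢_)
open import Relation.Nullary using (¬_)
open import Function.Definitions using (Injective)

record Graph (n : ℕ) : Set where
  field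
    adj    : Fin n → Fin n → Bool
    sym    : ∀ u v → adj u v ≡ adj v u
    irrefl : ∀ v → adj v v ≡ false
open Graph public

ℕ→ℚ : ℕ → ℚ
ℕ→ℚ m = + m / 1

degree : ∀ {n} → Graph n → Fin n → ℕ
degree G v = ∣ tabulate (adj G v) ∣

-- G ∈ 𝒞_d : maximum degree at most d
MaxDeg≤ : ∀ {n} → Graph n → ℕ → Set
MaxDeg≤ G d = ∀ v → degree G v ≤ d

edgeCount : ∀ {n} → Graph n → ℕ
edgeCount {n} G =
  sum (map (λ u → ∣ tabulate (λ v → (toℕ u <ᵇ toℕ v) ∧ adj G u v) ∣) (allFin n))

Hamiltonian : ∀ {n} → Graph n → Set
Hamiltonian {n} G =
  (3 ≤ n) × Σ (Fin n → Fin n) λ σ →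
    Injective _≡_ _≡_ σ
    × (∀ i j → toℕ j ≡ suc (toℕ i) → adj G (σ i) (σ j) ≡ true)
    × (∀ i j → toℕ i ≡ n ∸ 1 → toℕ j ≡ 0 → adj G (σ i) (σ j) ≡ true)

-- the symmetric difference (V(G), E(G) △ E), where E is given as a graph F
_△_ : ∀ {n} → Graph n → Graph n → Graph n
G △ F = record
  { adj = λ u v → adj G u v xor adj F u v
  ; sym = λ u v → eq (sym G u v) (sym F u v)
  ; irrefl = λ v → eq2 (irrefl G v) (irrefl F v) }
  where
  open import Relation.Binary.PropositionalEquality using (cong₂; refl)
  eq : ∀ {a b c d} → a ≡ b → c ≡ d → a xor c ≡ b xor d
  eq p q = cong₂ _xor_ p q
  eq2 : ∀ {a c} → a ≡ false → c ≡ false → a xor c ≡ false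
  eq2 refl refl = refl

N : ∀ {n} → Graph n → Subset n → Subset n
N {n} G S = tabulate (λ v → lookup S v ∨ any (λ w → lookup S w ∧ adj G v w) (allFin n))

_∈ᵇ_ : ∀ {n} → Fin n → Subset n → Set
v ∈ᵇ S = lookup S v ≡ true

-- An isomorphism from G[N_G(S)] to H[N_H(T)] mapping S onto T,
-- presented by functions f, g on Fin n whose restrictions to
-- N_G(S) resp. N_H(T) are mutually inverse bijections.
record Iso {n} (G : Graph n) (S : Subset n) (H : Graph n) (T : Subset n) : Set where
  field
    f g   : Fin n → Fin n
    f-in  : ∀ v → v ∈ᵇ N G S → f v ∈ᵇ N H T
    g-in  : ∀ u → u ∈ᵇ N H T → g u ∈ᵇ N G S
    gf    : ∀ v → v ∈ᵇ N G S → g (f v) ≡ v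
    fg    : ∀ u → u ∈ᵇ N H T → f (g u) ≡ u
    hom   : ∀ v w → v ∈ᵇ N G S → w ∈ᵇ N G S → adj H (f v) (f w) ≡ adj G v w
    onto  : ∀ v → v ∈ᵇ N G S → lookup T (f v) ≡ lookup S v

Witnesses : ∀ {n} → ℕ → Graph n → Subset n → Set
Witnesses {n} d G S =
  ∀ (H : Graph n) → MaxDeg≤ H d → Hamiltonian H → ∀ (T : Subset n) → ¬ Iso G S H T

EpsFar : ∀ {n} → ℚ → ℕ → Graph n → Set
EpsFar {n} ε d G =
  ∀ (E : Graph n) → ℕ→ℚ (edgeCount E) ℚ.≤ ε ℚ.* ℕ→ℚ d ℚ.* ℕ→ℚ n → ¬ Hamiltonian (G △ E)

-- Take λ strictly between 2dε and 1, and suppose G △ E is Hamiltonian for a set E of at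
-- most εdn edges. If every closed neighbourhood N(Sᵢ) contained an endpoint of an edge of E,
-- disjointness would give λn ≤ k ≤ 2|E| ≤ 2dεn < λn. So some N(Sᵢ) meets no edge of E.
-- Adding the edges of G inside N(Sᵢ) to a Hamilton cycle of G △ E gives a Hamiltonian
-- graph H of maximum degree at most d: a vertex of N(Sᵢ) only carries edges of G there, any
-- other vertex only its two cycle edges. The identity is then an isomorphism from
-- G[N_G(Sᵢ)] to H[N_H(Sᵢ)] fixing Sᵢ, so Sᵢ does not witness non-Hamiltonicity.

module Submission where

open import Defs hiding (sym)
open import Data.Nat as ℕ using (ℕ; suc; _+_; _*_; _∸_; _≤_; _<ᵇ_; z≤n; s≤s)
import Data.Nat.Properties as ℕ
import Data.Integer as ℤ
import Data.Integer.Properties as ℤ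
import Data.Nat.Coprimality as Coprime
open import Data.Rational as ℚ using (ℚ; 0ℚ; 1ℚ; ½; mkℚ)
import Data.Rational.Properties as ℚ
open import Data.Rational.Solver using (module +-*-Solver)
open import Data.Fin using (Fin; zero; suc; toℕ) renaming (_<_ to _<ᶠ_)
import Data.Fin.Properties as Fin
open import Data.Fin.Subset as Subset using (Subset; _∪_; ⁅_⁆; ∣_∣; inside; outside)
open import Data.Fin.Subset.Properties
  using (x∈p∪q⁺; p⊆q⇒∣p∣≤∣q∣; ∣p∣≤∣x∷p∣; ∣⁅x⁆∣≡1; ∣⊥∣≡0; x∈⁅x⁆; Empty-unique; nonempty?)
open import Data.Bool as Bool using (Bool; true; false; T; _∧_; _∨_; _xor_)
open import Data.Bool.Properties
  using (T?; T-≡; T-∧; T-∨; ∨-zeroʳ; ∨-comm; ∧-comm; ∧-zeroʳ; ¬-not; not-¬; ⇔→≡; xor-identityʳ)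
open import Data.Bool.ListAction using (any)
open import Data.List as List using (List; []; _∷_; _++_; length; concatMap; filterᵇ; allFin)
import Data.List.Properties as List
open import Data.Nat.ListAction using (sum)
open import Data.List.Membership.Propositional using (_∈_; lose)
open import Data.List.Membership.Propositional.Properties
  using (∈-allFin; ∈-map⁺; ∈-filter⁺; ∈-concatMap⁺; ∈-++⁺ˡ; ∈-++⁺ʳ)
open import Data.List.Relation.Unary.Any as Any using (satisfied)
open import Data.List.Relation.Unary.Any.Properties using (lookup-index; any⁺; any⁻)
open import Data.Vec using ([]; _∷_; tabulate; lookup)
open import Data.Vec.Properties using (lookup∘tabulate; lookup⇒[]=; []=⇒lookup)
open import Data.Product using (Σ; ∃-syntax; _×_; _,_; proj₁; proj₂; map; map₂)
open import Data.Sum using (_⊎_; inj₁; inj₂)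
open import Data.Empty using (⊥; ⊥-elim)
open import Function using (Equivalence; _∘_; id; mk⇔)
open import Function.Definitions using (Injective)
open import Relation.Nullary using (Dec; yes; no; does; ¬_)
open import Relation.Nullary.Decidable using (dec-true; _×-dec_; _⊎-dec_)
open import Relation.Binary.Definitions using (tri<; tri≈; tri>)
open import Relation.Binary.PropositionalEquality
  using (_≡_; _≢_; refl; sym; trans; cong; cong₂; subst; subst₂; module ≡-Reasoning)

∈-tabulate⁺ : ∀ {n} {f : Fin n → Bool} {x} → f x ≡ true → x Subset.∈ tabulate f
∈-tabulate⁺ {f = f} {x} fx = lookup⇒[]= x (tabulate f) (trans (lookup∘tabulate f x) fx)

∈-tabulate⁻ : ∀ {n} {f : Fin n → Bool} {x} → x Subset.∈ tabulate f → f x ≡ true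
∈-tabulate⁻ {f = f} {x} x∈ = trans (sym (lookup∘tabulate f x)) ([]=⇒lookup x∈)

∣p∪q∣≤∣p∣+∣q∣ : ∀ {n} (p q : Subset n) → ∣ p ∪ q ∣ ≤ ∣ p ∣ + ∣ q ∣
∣p∪q∣≤∣p∣+∣q∣ [] [] = z≤n
∣p∪q∣≤∣p∣+∣q∣ (outside ∷ p) (outside ∷ q) = ∣p∪q∣≤∣p∣+∣q∣ p q
∣p∪q∣≤∣p∣+∣q∣ (outside ∷ p) (inside ∷ q) =
  subst (suc ∣ p ∪ q ∣ ≤_) (sym (ℕ.+-suc ∣ p ∣ ∣ q ∣)) (s≤s (∣p∪q∣≤∣p∣+∣q∣ p q))
∣p∪q∣≤∣p∣+∣q∣ (inside ∷ p) (x ∷ q) =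
  s≤s (ℕ.≤-trans (∣p∪q∣≤∣p∣+∣q∣ p q) (ℕ.+-monoʳ-≤ ∣ p ∣ (∣p∣≤∣x∷p∣ x q)))

∣p∣≤1 : ∀ {n} {p : Subset n} → (∀ {x y} → x Subset.∈ p → y Subset.∈ p → x ≡ y) → ∣ p ∣ ≤ 1
∣p∣≤1 {n} {p} unique with nonempty? p
... | yes (x , x∈p) =
  ℕ.≤-trans (p⊆q⇒∣p∣≤∣q∣ {p = p} (λ y∈p → subst (Subset._∈ ⁅ x ⁆) (unique x∈p y∈p) (x∈⁅x⁆ x)))
            (ℕ.≤-reflexive (∣⁅x⁆∣≡1 x))
... | no p-empty = subst (_≤ 1) (sym (trans (cong ∣_∣ (Empty-unique p-empty)) (∣⊥∣≡0 n))) z≤n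

degree-mono : ∀ {n} (G H : Graph n) u → (∀ v → adj H u v ≡ true → adj G u v ≡ true) →
              degree H u ≤ degree G u
degree-mono G H u H⊆G =
  p⊆q⇒∣p∣≤∣q∣ {p = tabulate (adj H u)} (λ v∈ → ∈-tabulate⁺ (H⊆G _ (∈-tabulate⁻ v∈)))

module _ {n} (G : Graph n) (S : Subset n) where

  ∈N⁺ˡ : ∀ {v} → v ∈ᵇ S → v ∈ᵇ N G S
  ∈N⁺ˡ {v} v∈S =
    trans (lookup∘tabulate _ v) (cong (_∨ any (λ w → lookup S w ∧ adj G v w) (allFin n)) v∈S)

  ∈N⁺ʳ : ∀ {v w} → w ∈ᵇ S → adj G v w ≡ true → v ∈ᵇ N G S
  ∈N⁺ʳ {v} {w} w∈S v~w =
    trans (lookup∘tabulate _ v) (trans (cong (lookup S v ∨_) some-neighbour) (∨-zeroʳ _))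
    where
    some-neighbour : any (λ w → lookup S w ∧ adj G v w) (allFin n) ≡ true
    some-neighbour = Equivalence.to T-≡
      (any⁺ _ (lose (∈-allFin w) (Equivalence.from T-≡ (cong₂ _∧_ w∈S v~w))))

  ∈N⁻ : ∀ {v} → v ∈ᵇ N G S → v ∈ᵇ S ⊎ ∃[ w ] (w ∈ᵇ S × adj G v w ≡ true)
  ∈N⁻ {v} v∈N with Equivalence.to T-∨ (Equivalence.from T-≡ (trans (sym (lookup∘tabulate _ v)) v∈N))
  ... | inj₁ v∈S = inj₁ (Equivalence.to T-≡ v∈S)
  ... | inj₂ some-neighbour =
    inj₂ (map₂ (map T⇒≡ T⇒≡ ∘ Equivalence.to T-∧) (satisfied (any⁻ _ (allFin n) some-neighbour)))
    where
    T⇒≡ : ∀ {b} → T b → b ≡ true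
    T⇒≡ = Equivalence.to T-≡

dec-true⁻ : ∀ {A : Set} (a? : Dec A) → does a? ≡ true → A
dec-true⁻ (yes a) _ = a

_∪ᴳ_ : ∀ {n} → Graph n → Graph n → Graph n
G ∪ᴳ H = record
  { adj    = λ u v → adj G u v ∨ adj H u v
  ; sym    = λ u v → cong₂ _∨_ (Graph.sym G u v) (Graph.sym H u v)
  ; irrefl = λ v → cong₂ _∨_ (irrefl G v) (irrefl H v)
  }

_↾_ : ∀ {n} → Graph n → Subset n → Graph n
G ↾ X = record
  { adj    = λ u v → (lookup X u ∧ lookup X v) ∧ adj G u v
  ; sym    = λ u v → cong₂ _∧_ (∧-comm (lookup X u) (lookup X v)) (Graph.sym G u v)
  ; irrefl = λ v → trans (cong ((lookup X v ∧ lookup X v) ∧_) (irrefl G v)) (∧-zeroʳ _)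
  }

Consecutive : ∀ {n} → Fin n → Fin n → Set
Consecutive {n} i j = toℕ j ≡ suc (toℕ i) ⊎ (toℕ i ≡ n ∸ 1 × toℕ j ≡ 0)

consecutive? : ∀ {n} (i j : Fin n) → Dec (Consecutive i j)
consecutive? {n} i j = (toℕ j ℕ.≟ suc (toℕ i)) ⊎-dec ((toℕ i ℕ.≟ n ∸ 1) ×-dec (toℕ j ℕ.≟ 0))

consecutive-functionalʳ : ∀ {n} {i j j′ : Fin n} → Consecutive i j → Consecutive i j′ → j ≡ j′
consecutive-functionalʳ (inj₁ j≡1+i) (inj₁ j′≡1+i) = Fin.toℕ-injective (trans j≡1+i (sym j′≡1+i))
consecutive-functionalʳ (inj₂ (_ , j≡0)) (inj₂ (_ , j′≡0)) =
  Fin.toℕ-injective (trans j≡0 (sym j′≡0))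
consecutive-functionalʳ {suc m} {j = j} (inj₁ j≡1+i) (inj₂ (i≡m , _)) =
  ⊥-elim (ℕ.<-irrefl refl (subst (ℕ._< suc m) (trans j≡1+i (cong suc i≡m)) (Fin.toℕ<n j)))
consecutive-functionalʳ {suc m} {j′ = j′} (inj₂ (i≡m , _)) (inj₁ j′≡1+i) =
  ⊥-elim (ℕ.<-irrefl refl (subst (ℕ._< suc m) (trans j′≡1+i (cong suc i≡m)) (Fin.toℕ<n j′)))

consecutive-functionalˡ : ∀ {n} {i i′ j : Fin n} → Consecutive i j → Consecutive i′ j → i ≡ i′
consecutive-functionalˡ (inj₁ j≡1+i) (inj₁ j≡1+i′) =
  Fin.toℕ-injective (ℕ.suc-injective (trans (sym j≡1+i) j≡1+i′))
consecutive-functionalˡ (inj₂ (i≡m , _)) (inj₂ (i′≡m , _)) =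
  Fin.toℕ-injective (trans i≡m (sym i′≡m))
consecutive-functionalˡ (inj₁ j≡1+i) (inj₂ (_ , j≡0)) with () ← trans (sym j≡1+i) j≡0
consecutive-functionalˡ (inj₂ (_ , j≡0)) (inj₁ j≡1+i′) with () ← trans (sym j≡1+i′) j≡0

IsHamiltonCycle : ∀ {n} → Graph n → (Fin n → Fin n) → Set
IsHamiltonCycle K σ = Injective _≡_ _≡_ σ × (∀ {i j} → Consecutive i j → adj K (σ i) (σ j) ≡ true)

module _ {n} {K : Graph n} where

  Hamiltonian⇒cycle : Hamiltonian K → 3 ≤ n × ∃[ σ ] IsHamiltonCycle K σ
  Hamiltonian⇒cycle (3≤n , σ , σ-inj , edge , closing-edge) = 3≤n , σ , σ-inj , cycle-edge
    where
    cycle-edge : ∀ {i j} → Consecutive i j → adj K (σ i) (σ j) ≡ true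
    cycle-edge (inj₁ j≡1+i) = edge _ _ j≡1+i
    cycle-edge (inj₂ (i≡last , j≡0)) = closing-edge _ _ i≡last j≡0

  cycle⇒Hamiltonian : ∀ {σ} → 3 ≤ n → IsHamiltonCycle K σ → Hamiltonian K
  cycle⇒Hamiltonian {σ} 3≤n (σ-inj , cycle-edge) =
    3≤n , σ , σ-inj , (λ _ _ j≡1+i → cycle-edge (inj₁ j≡1+i))
                    , (λ _ _ i≡last j≡0 → cycle-edge (inj₂ (i≡last , j≡0)))

module HamiltonCycle {n} (K : Graph n) (σ : Fin n → Fin n) (σ-cycle : IsHamiltonCycle K σ) where

  Step : Fin n → Fin n → Set
  Step u v = ∃[ i ] ∃[ j ] (Consecutive i j × σ i ≡ u × σ j ≡ v)

  step? : ∀ u v → Dec (Step u v)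
  step? u v =
    Fin.any? λ i → Fin.any? λ j → consecutive? i j ×-dec ((σ i Fin.≟ u) ×-dec (σ j Fin.≟ v))

  step-functional : ∀ {u v w} → Step u v → Step u w → v ≡ w
  step-functional (i , j , i→j , refl , refl) (i′ , j′ , i′→j′ , σi′≡σi , refl)
    with refl ← proj₁ σ-cycle σi′≡σi = cong σ (consecutive-functionalʳ i→j i′→j′)

  step-injective : ∀ {u v w} → Step u w → Step v w → u ≡ v
  step-injective (i , j , i→j , refl , refl) (i′ , j′ , i′→j′ , refl , σj′≡σj)
    with refl ← proj₁ σ-cycle σj′≡σj = cong σ (consecutive-functionalˡ i→j i′→j′)

  step-edge : ∀ {u v} → Step u v → adj K u v ≡ true
  step-edge (i , j , i→j , refl , refl) = proj₂ σ-cycle i→j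

  cycleAdj : Fin n → Fin n → Bool
  cycleAdj u v = does (step? u v) ∨ does (step? v u)

  cycleAdj⇒step : ∀ {u v} → cycleAdj u v ≡ true → Step u v ⊎ Step v u
  cycleAdj⇒step {u} {v} e with Equivalence.to T-∨ (Equivalence.from T-≡ e)
  ... | inj₁ u→v = inj₁ (dec-true⁻ (step? u v) (Equivalence.to T-≡ u→v))
  ... | inj₂ v→u = inj₂ (dec-true⁻ (step? v u) (Equivalence.to T-≡ v→u))

  cycleAdj⊆K : ∀ {u v} → cycleAdj u v ≡ true → adj K u v ≡ true
  cycleAdj⊆K e with cycleAdj⇒step e
  ... | inj₁ u→v = step-edge u→v
  ... | inj₂ v→u = trans (Graph.sym K _ _) (step-edge v→u)

  cycleGraph : Graph n
  cycleGraph = record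
    { adj    = cycleAdj
    ; sym    = λ u v → ∨-comm (does (step? u v)) (does (step? v u))
    ; irrefl = λ v → ¬-not λ v~v → not-¬ refl (trans (sym (cycleAdj⊆K v~v)) (irrefl K v))
    }

  cycleGraph-hamiltonian : 3 ≤ n → Hamiltonian cycleGraph
  cycleGraph-hamiltonian 3≤n = cycle⇒Hamiltonian {K = cycleGraph} 3≤n (proj₁ σ-cycle , cycle-step)
    where
    cycle-step : ∀ {i j} → Consecutive i j → cycleAdj (σ i) (σ j) ≡ true
    cycle-step {i} {j} i→j =
      cong (_∨ does (step? (σ j) (σ i))) (dec-true (step? (σ i) (σ j)) (i , j , i→j , refl , refl))

  cycleGraph-maxDeg≤2 : MaxDeg≤ cycleGraph 2
  cycleGraph-maxDeg≤2 u = begin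
    ∣ tabulate (cycleAdj u) ∣           ≤⟨ p⊆q⇒∣p∣≤∣q∣ {p = tabulate (cycleAdj u)} neighbours⊆ ⟩
    ∣ successors ∪ predecessors ∣      ≤⟨ ∣p∪q∣≤∣p∣+∣q∣ successors predecessors ⟩
    ∣ successors ∣ + ∣ predecessors ∣  ≤⟨ ℕ.+-mono-≤ (∣p∣≤1 λ x y → step-functional (from x) (from y))
                                                     (∣p∣≤1 λ x y → step-injective (to x) (to y)) ⟩
    2                                  ∎
    where
    open ℕ.≤-Reasoning
    successors predecessors : Subset n
    successors = tabulate (λ v → does (step? u v))
    predecessors = tabulate (λ v → does (step? v u))
    from : ∀ {v} → v Subset.∈ successors → Step u v
    from {v} v∈ = dec-true⁻ (step? u v) (∈-tabulate⁻ v∈)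
    to : ∀ {v} → v Subset.∈ predecessors → Step v u
    to {v} v∈ = dec-true⁻ (step? v u) (∈-tabulate⁻ v∈)
    neighbours⊆ : tabulate (cycleAdj u) Subset.⊆ (successors ∪ predecessors)
    neighbours⊆ {v} v∈ with cycleAdj⇒step (∈-tabulate⁻ v∈)
    ... | inj₁ u→v = x∈p∪q⁺ (inj₁ (∈-tabulate⁺ (dec-true (step? u v) u→v)))
    ... | inj₂ v→u = x∈p∪q⁺ (inj₂ (∈-tabulate⁺ (dec-true (step? v u) v→u)))

Hamiltonian-mono : ∀ {n} {C H : Graph n} → (∀ {u v} → adj C u v ≡ true → adj H u v ≡ true) →
                   Hamiltonian C → Hamiltonian H
Hamiltonian-mono C⊆H (3≤n , σ , σ-inj , edge , closing-edge) =
  3≤n , σ , σ-inj , (λ i j j≡1+i → C⊆H (edge i j j≡1+i))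
                  , (λ i j i≡last j≡0 → C⊆H (closing-edge i j i≡last j≡0))

Iso-id : ∀ {n} (G H : Graph n) (S : Subset n) →
         (∀ {u v} → u ∈ᵇ N G S → v ∈ᵇ N G S → adj G u v ≡ true → adj H u v ≡ true) →
         (∀ {u v} → u ∈ᵇ N G S → adj H u v ≡ true → adj G u v ≡ true) →
         Iso G S H S
Iso-id G H S G⊆H H⊆G = record
  { f = id ; g = id
  ; f-in = λ _ → N-G⊆N-H ; g-in = λ _ → N-H⊆N-G
  ; gf = λ _ _ → refl ; fg = λ _ _ → refl
  ; hom = λ _ _ u∈N v∈N → ⇔→≡ (mk⇔ (H⊆G u∈N) (G⊆H u∈N v∈N))
  ; onto = λ _ _ → refl
  }
  where
  N-G⊆N-H : ∀ {v} → v ∈ᵇ N G S → v ∈ᵇ N H S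
  N-G⊆N-H v∈N with ∈N⁻ G S v∈N
  ... | inj₁ v∈S = ∈N⁺ˡ H S v∈S
  ... | inj₂ (w , w∈S , v~w) = ∈N⁺ʳ H S w∈S (G⊆H v∈N (∈N⁺ˡ G S w∈S) v~w)

  N-H⊆N-G : ∀ {v} → v ∈ᵇ N H S → v ∈ᵇ N G S
  N-H⊆N-G {v} v∈N with ∈N⁻ H S v∈N
  ... | inj₁ v∈S = ∈N⁺ˡ G S v∈S
  ... | inj₂ (w , w∈S , v~w) =
    ∈N⁺ʳ G S w∈S (trans (Graph.sym G v w) (H⊆G (∈N⁺ˡ G S w∈S) (trans (Graph.sym H w v) v~w)))

untouched⇒¬Witnesses : ∀ {n d} (G E : Graph n) (S : Subset n) → 2 ≤ d → MaxDeg≤ G d →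
                       Hamiltonian (G △ E) → (∀ {v} → v ∈ᵇ N G S → ∀ x → adj E v x ≡ false) →
                       ¬ Witnesses d G S
untouched⇒¬Witnesses {n} {d} G E S 2≤d Δ≤d ham untouched witnesses
  with 3≤n , σ , σ-cycle ← Hamiltonian⇒cycle {K = G △ E} ham =
  witnesses H H-maxDeg (Hamiltonian-mono {C = cycleGraph} {H} C⊆H (cycleGraph-hamiltonian 3≤n))
            S (Iso-id G H S G⊆H H⊆G)
  where
  open HamiltonCycle (G △ E) σ σ-cycle

  H : Graph n
  H = (G ↾ N G S) ∪ᴳ cycleGraph

  C⊆H : ∀ {u v} → cycleAdj u v ≡ true → adj H u v ≡ true
  C⊆H {u} {v} c = trans (cong (adj (G ↾ N G S) u v ∨_) c) (∨-zeroʳ _)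

  △≡G-near-S : ∀ {u} → u ∈ᵇ N G S → ∀ v → adj (G △ E) u v ≡ adj G u v
  △≡G-near-S u∈N v = trans (cong (adj G _ v xor_) (untouched u∈N v)) (xor-identityʳ _)

  G⊆H : ∀ {u v} → u ∈ᵇ N G S → v ∈ᵇ N G S → adj G u v ≡ true → adj H u v ≡ true
  G⊆H {u} {v} u∈N v∈N u~v = cong (_∨ cycleAdj u v) (cong₂ _∧_ (cong₂ _∧_ u∈N v∈N) u~v)

  H⊆G : ∀ {u v} → u ∈ᵇ N G S → adj H u v ≡ true → adj G u v ≡ true
  H⊆G {u} {v} u∈N u~v with Equivalence.to (T-∨ {adj (G ↾ N G S) u v}) (Equivalence.from T-≡ u~v)
  ... | inj₁ induced =
    Equivalence.to T-≡ (proj₂ (Equivalence.to (T-∧ {lookup (N G S) u ∧ lookup (N G S) v}) induced))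
  ... | inj₂ cycle = trans (sym (△≡G-near-S u∈N v)) (cycleAdj⊆K (Equivalence.to T-≡ cycle))

  H-maxDeg : MaxDeg≤ H d
  H-maxDeg u = degree-bound (lookup (N G S) u) refl
    where
    degree-bound : ∀ b → lookup (N G S) u ≡ b → degree H u ≤ d
    degree-bound true u∈N = ℕ.≤-trans (degree-mono G H u (λ _ → H⊆G u∈N)) (Δ≤d u)
    degree-bound false u∉N =
      ℕ.≤-trans (degree-mono cycleGraph H u H⊆C) (ℕ.≤-trans (cycleGraph-maxDeg≤2 u) 2≤d)
      where
      H⊆C : ∀ v → adj H u v ≡ true → cycleAdj u v ≡ true
      H⊆C v = subst (λ b → (b ∧ lookup (N G S) v) ∧ adj G u v ∨ cycleAdj u v ≡ true) u∉N

injective⇒≤length : ∀ {k} {A : Set} {xs : List A} (h : Fin k → A) → Injective _≡_ _≡_ h →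
                    (∀ i → h i ∈ xs) → k ≤ length xs
injective⇒≤length {xs = xs} h h-inj h∈xs = Fin.injective⇒≤ {f = λ i → Any.index (h∈xs i)} index-inj
  where
  index-inj : ∀ {i j} → Any.index (h∈xs i) ≡ Any.index (h∈xs j) → i ≡ j
  index-inj {i} {j} e = h-inj (trans (lookup-index (h∈xs i))
                                     (trans (cong (List.lookup xs) e) (sym (lookup-index (h∈xs j)))))

length-concatMap : ∀ {A B : Set} (f : A → List B) xs →
                   length (concatMap f xs) ≡ sum (List.map (length ∘ f) xs)
length-concatMap f [] = refl
length-concatMap f (x ∷ xs) =
  trans (List.length-++ (f x)) (cong (length (f x) +_) (length-concatMap f xs))

length-filterᵇ-tabulate : ∀ {n} {A : Set} (p : A → Bool) (g : Fin n → A) →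
                          length (filterᵇ p (List.tabulate g)) ≡ ∣ tabulate (p ∘ g) ∣
length-filterᵇ-tabulate {ℕ.zero} p g = refl
length-filterᵇ-tabulate {suc n} p g with p (g zero)
... | true = cong suc (length-filterᵇ-tabulate p (g ∘ suc))
... | false = length-filterᵇ-tabulate p (g ∘ suc)

module EdgeSlots {n} (E : Graph n) where

  forward : Fin n → Fin n → Bool
  forward u v = (toℕ u <ᵇ toℕ v) ∧ adj E u v

  forwardEdgesFrom : Fin n → List (Fin n × Fin n)
  forwardEdgesFrom u = List.map (u ,_) (filterᵇ (forward u) (allFin n))

  edgeList : List (Fin n × Fin n)
  edgeList = concatMap forwardEdgesFrom (allFin n)

  length-edgeList : length edgeList ≡ edgeCount E
  length-edgeList =
    trans (length-concatMap _ (allFin n)) (cong sum (List.map-cong count-row (allFin n)))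
    where
    count-row : ∀ u → length (forwardEdgesFrom u) ≡ ∣ tabulate (forward u) ∣
    count-row u = trans (List.length-map (u ,_) (filterᵇ (forward u) (allFin n)))
                        (length-filterᵇ-tabulate (forward u) id)

  ∈-edgeList : ∀ {u v} → u <ᶠ v → adj E u v ≡ true → (u , v) ∈ edgeList
  ∈-edgeList {u} {v} u<v u~v = ∈-concatMap⁺ forwardEdgesFrom
    (lose (∈-allFin u) (∈-map⁺ (u ,_) (∈-filter⁺ (T? ∘ forward u) (∈-allFin v) forward-uv)))
    where
    forward-uv : T (forward u v)
    forward-uv = Equivalence.from T-≡ (cong₂ _∧_ (Equivalence.to T-≡ (ℕ.<⇒<ᵇ u<v)) u~v)

  -- every edge u < v contributes one slot for each of its endpoints
  Slot : Set
  Slot = (Fin n × Fin n) × Bool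

  slots : List Slot
  slots = List.map (_, true) edgeList ++ List.map (_, false) edgeList

  length-slots : length slots ≡ 2 * edgeCount E
  length-slots = begin
    length slots
      ≡⟨ List.length-++ (List.map (_, true) edgeList) ⟩
    length (List.map (_, true) edgeList) + length (List.map (_, false) edgeList)
      ≡⟨ cong₂ _+_ (List.length-map (_, true) edgeList) (List.length-map (_, false) edgeList) ⟩
    length edgeList + length edgeList
      ≡⟨ cong (λ e → e + e) length-edgeList ⟩
    edgeCount E + edgeCount E
      ≡⟨ cong (edgeCount E +_) (sym (ℕ.+-identityʳ (edgeCount E))) ⟩
    2 * edgeCount E
      ∎
    where open ≡-Reasoning

  endpoint : Slot → Fin n
  endpoint ((u , _) , true) = u
  endpoint ((_ , v) , false) = v

  slotAt : Fin n → Fin n → Slot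
  slotAt v x with Fin.<-cmp v x
  ... | tri< _ _ _ = (v , x) , true
  ... | tri≈ _ _ _ = (v , x) , true   -- junk: a loop is never an edge
  ... | tri> _ _ _ = (x , v) , false

  endpoint-slotAt : ∀ v x → endpoint (slotAt v x) ≡ v
  endpoint-slotAt v x with Fin.<-cmp v x
  ... | tri< _ _ _ = refl
  ... | tri≈ _ _ _ = refl
  ... | tri> _ _ _ = refl

  slotAt∈slots : ∀ {v x} → adj E v x ≡ true → slotAt v x ∈ slots
  slotAt∈slots {v} {x} v~x with Fin.<-cmp v x
  ... | tri< v<x _ _ = ∈-++⁺ˡ (∈-map⁺ (_, true) (∈-edgeList v<x v~x))
  ... | tri≈ _ refl _ with () ← trans (sym v~x) (irrefl E v)
  ... | tri> _ _ x<v = ∈-++⁺ʳ (List.map (_, true) edgeList)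
                          (∈-map⁺ (_, false) (∈-edgeList x<v (trans (Graph.sym E x v) v~x)))

distinctEndpoints≤2*edgeCount : ∀ {n k} (E : Graph n) (v x : Fin k → Fin n) →
                                (∀ i → adj E (v i) (x i) ≡ true) → Injective _≡_ _≡_ v →
                                k ≤ 2 * edgeCount E
distinctEndpoints≤2*edgeCount E v x v~x v-inj =
  subst (_ ≤_) length-slots
    (injective⇒≤length (λ i → slotAt (v i) (x i)) slot-inj (λ i → slotAt∈slots (v~x i)))
  where
  open EdgeSlots E
  slot-inj : ∀ {i j} → slotAt (v i) (x i) ≡ slotAt (v j) (x j) → i ≡ j
  slot-inj {i} {j} e = v-inj (trans (sym (endpoint-slotAt (v i) (x i)))
                                    (trans (cong endpoint e) (endpoint-slotAt (v j) (x j))))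

Touches : ∀ {n} → Graph n → Subset n → Set
Touches E X = ∃[ v ] (v ∈ᵇ X × ∃[ x ] adj E v x ≡ true)

touches? : ∀ {n} (E : Graph n) (X : Subset n) → Dec (Touches E X)
touches? E X = Fin.any? λ v → (lookup X v Bool.≟ true) ×-dec Fin.any? λ x → adj E v x Bool.≟ true

¬Touches⇒edgeless : ∀ {n} {E : Graph n} {X} → ¬ Touches E X →
                    ∀ {v} → v ∈ᵇ X → ∀ x → adj E v x ≡ false
¬Touches⇒edgeless ¬touches v∈X x = ¬-not λ v~x → ¬touches (_ , v∈X , x , v~x)

disjointTouched≤2*edgeCount : ∀ {n k} (E : Graph n) (X : Fin k → Subset n) →
  (∀ i j → i ≢ j → ∀ v → v ∈ᵇ X i → v ∈ᵇ X j → ⊥) → (∀ i → Touches E (X i)) → k ≤ 2 * edgeCount E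
disjointTouched≤2*edgeCount E X disjoint touched =
  distinctEndpoints≤2*edgeCount E (proj₁ ∘ touched) (proj₁ ∘ proj₂ ∘ proj₂ ∘ touched)
    (proj₂ ∘ proj₂ ∘ proj₂ ∘ touched) endpoint-inj
  where
  endpoint-inj : Injective _≡_ _≡_ (proj₁ ∘ touched)
  endpoint-inj {i} {j} vᵢ≡vⱼ with i Fin.≟ j
  ... | yes i≡j = i≡j
  ... | no i≢j = ⊥-elim (disjoint i j i≢j _ (proj₁ (proj₂ (touched i)))
                          (subst (_∈ᵇ X j) (sym vᵢ≡vⱼ) (proj₁ (proj₂ (touched j)))))

ℕ→ℚ≡mkℚ : ∀ m → ℕ→ℚ m ≡ mkℚ (ℤ.+ m) 0 (Coprime.sym (Coprime.1-coprimeTo m))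
ℕ→ℚ≡mkℚ m = ℚ.normalize-coprime (Coprime.sym (Coprime.1-coprimeTo m))

ℕ→ℚ-* : ∀ a b → ℕ→ℚ (a * b) ≡ ℕ→ℚ a ℚ.* ℕ→ℚ b
ℕ→ℚ-* a b rewrite ℕ→ℚ≡mkℚ a | ℕ→ℚ≡mkℚ b = cong (ℚ._/ 1) (ℤ.pos-* a b)

ℕ→ℚ-mono-≤ : ∀ {a b} → a ≤ b → ℕ→ℚ a ℚ.≤ ℕ→ℚ b
ℕ→ℚ-mono-≤ {a} {b} a≤b rewrite ℕ→ℚ≡mkℚ a | ℕ→ℚ≡mkℚ b =
  ℚ.*≤* (subst₂ ℤ._≤_ (sym (ℤ.*-identityʳ (ℤ.+ a))) (sym (ℤ.*-identityʳ (ℤ.+ b))) (ℤ.+≤+ a≤b))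

ℕ→ℚ-nonNeg : ∀ m → ℚ.NonNegative (ℕ→ℚ m)
ℕ→ℚ-nonNeg m rewrite ℕ→ℚ≡mkℚ m = _

ℕ→ℚ-pos : ∀ {m} → 1 ≤ m → ℚ.Positive (ℕ→ℚ m)
ℕ→ℚ-pos {suc m} _ rewrite ℕ→ℚ≡mkℚ (suc m) = _

½*[x+x]≡x : ∀ x → ½ ℚ.* (x ℚ.+ x) ≡ x
½*[x+x]≡x x = begin
  ½ ℚ.* (x ℚ.+ x)         ≡⟨ ℚ.*-distribˡ-+ ½ x x ⟩
  ½ ℚ.* x ℚ.+ ½ ℚ.* x     ≡⟨ ℚ.*-distribʳ-+ x ½ ½ ⟨
  (½ ℚ.+ ½) ℚ.* x         ≡⟨ ℚ.*-identityˡ x ⟩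
  x                       ∎
  where open ≡-Reasoning

<-midpointˡ : ∀ {x y} → x ℚ.< y → x ℚ.< ½ ℚ.* (x ℚ.+ y)
<-midpointˡ {x} {y} x<y =
  subst (ℚ._< ½ ℚ.* (x ℚ.+ y)) (½*[x+x]≡x x) (ℚ.*-monoʳ-<-pos ½ (ℚ.+-monoʳ-< x x<y))

<-midpointʳ : ∀ {x y} → x ℚ.< y → ½ ℚ.* (x ℚ.+ y) ℚ.< y
<-midpointʳ {x} {y} x<y =
  subst (½ ℚ.* (x ℚ.+ y) ℚ.<_) (½*[x+x]≡x y) (ℚ.*-monoʳ-<-pos ½ (ℚ.+-monoˡ-< y x<y))

ℕ→ℚ-2*-bound : ∀ ε d r e → ℕ→ℚ e ℚ.≤ ε ℚ.* ℕ→ℚ d ℚ.* r → ℕ→ℚ (2 * e) ℚ.≤ ε ℚ.* ℕ→ℚ (2 * d) ℚ.* r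
ℕ→ℚ-2*-bound ε d r e e≤εdr = begin
  ℕ→ℚ (2 * e)                      ≡⟨ ℕ→ℚ-* 2 e ⟩
  ℕ→ℚ 2 ℚ.* ℕ→ℚ e                  ≤⟨ ℚ.*-monoˡ-≤-nonNeg (ℕ→ℚ 2) e≤εdr ⟩
  ℕ→ℚ 2 ℚ.* (ε ℚ.* ℕ→ℚ d ℚ.* r)    ≡⟨ solve 4 (λ t ε d r → t :* (ε :* d :* r) := ε :* (t :* d) :* r)
                                              refl (ℕ→ℚ 2) ε (ℕ→ℚ d) r ⟩
  ε ℚ.* (ℕ→ℚ 2 ℚ.* ℕ→ℚ d) ℚ.* r    ≡⟨ cong (λ t → ε ℚ.* t ℚ.* r) (ℕ→ℚ-* 2 d) ⟨
  ε ℚ.* ℕ→ℚ (2 * d) ℚ.* r          ∎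
  where
  open ℚ.≤-Reasoning
  open +-*-Solver

disjointWitnesses⇒EpsFar : ∀ {n d k} {ε λ′ : ℚ} (G : Graph n) (S : Fin k → Subset n) → 2 ≤ d →
  ε ℚ.* ℕ→ℚ (2 * d) ℚ.< λ′ → MaxDeg≤ G d → λ′ ℚ.* ℕ→ℚ n ℚ.≤ ℕ→ℚ k →
  (∀ i j → i ≢ j → ∀ v → v ∈ᵇ N G (S i) → v ∈ᵇ N G (S j) → ⊥) → (∀ i → Witnesses d G (S i)) →
  EpsFar ε d G
disjointWitnesses⇒EpsFar {n} {d} {k} {ε} {λ′} G S 2≤d 2dε<λ Δ≤d λn≤k disjoint witnesses
                         E |E|≤εdn ham with Fin.all? (touches? E ∘ N G ∘ S)
... | no ¬all-touched with i , ¬touched ← Fin.¬∀⟶∃¬ k _ (touches? E ∘ N G ∘ S) ¬all-touched =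
  untouched⇒¬Witnesses G E (S i) 2≤d Δ≤d ham (¬Touches⇒edgeless {E = E} {N G (S i)} ¬touched)
                       (witnesses i)
... | yes all-touched = ℚ.<-irrefl refl (begin-strict
  ε ℚ.* ℕ→ℚ (2 * d) ℚ.* ℕ→ℚ n   <⟨ ℚ.*-monoˡ-<-pos (ℕ→ℚ n) {{ℕ→ℚ-pos 1≤n}} 2dε<λ ⟩
  λ′ ℚ.* ℕ→ℚ n                  ≤⟨ λn≤k ⟩
  ℕ→ℚ k                         ≤⟨ ℕ→ℚ-mono-≤ (disjointTouched≤2*edgeCount E (N G ∘ S) disjoint
                                                                           all-touched) ⟩
  ℕ→ℚ (2 * edgeCount E)         ≤⟨ ℕ→ℚ-2*-bound ε d (ℕ→ℚ n) (edgeCount E) |E|≤εdn ⟩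
  ε ℚ.* ℕ→ℚ (2 * d) ℚ.* ℕ→ℚ n   ∎)
  where
  open ℚ.≤-Reasoning
  1≤n : 1 ≤ n
  1≤n = ℕ.≤-trans (s≤s z≤n) (proj₁ ham)

lemma3p4 : (d : ℕ) → 2 ≤ d → (ε : ℚ) → 0ℚ ℚ.≤ ε → ε ℚ.* ℕ→ℚ (2 * d) ℚ.< 1ℚ →
    Σ ℚ λ λ′ → (0ℚ ℚ.< λ′) × (λ′ ℚ.< 1ℚ) ×
      (∀ (n : ℕ) (G : Graph n) → MaxDeg≤ G d →
        ∀ (k : ℕ) (S : Fin k → Subset n) →
        λ′ ℚ.* ℕ→ℚ n ℚ.≤ ℕ→ℚ k →
        (∀ i j → i ≢ j → ∀ v → v ∈ᵇ N G (S i) → v ∈ᵇ N G (S j) → ⊥) →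
        (∀ i → Witnesses d G (S i)) →
        EpsFar ε d G)
lemma3p4 d 2≤d ε 0≤ε 2dε<1 =
  λ′ , ℚ.≤-<-trans 0≤2dε 2dε<λ′ , <-midpointʳ 2dε<1 ,
  λ n G Δ≤d k S → disjointWitnesses⇒EpsFar {ε = ε} G S 2≤d 2dε<λ′ Δ≤d
  where
  2dε = ε ℚ.* ℕ→ℚ (2 * d)
  λ′ = ½ ℚ.* (2dε ℚ.+ 1ℚ)

  2dε<λ′ : 2dε ℚ.< λ′
  2dε<λ′ = <-midpointˡ 2dε<1

  0≤2dε : 0ℚ ℚ.≤ 2dε
  0≤2dε = subst (ℚ._≤ 2dε) (ℚ.*-zeroˡ (ℕ→ℚ (2 * d)))
                (ℚ.*-monoʳ-≤-nonNeg (ℕ→ℚ (2 * d)) {{ℕ→ℚ-nonNeg (2 * d)}} 0≤ε)
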